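{- Let $D$ be a digraph (finite, without loops or multiple arcs). Then $D$ admits a weak directed intersection representation if and only if each strongly connected component $C$ of $D$ is obtained from its underlying graph $U(C)$ by replacing each edge with a pair of oppositely oriented arcs.
   Context: A weak directed intersection representation of a digraph $D=(V,A)$ is a pair $(U,\varphi)$ where $U$ is a finite set and $\varphi$ assigns to each $v\in V$ a set $\varphi(v)\subseteq U$ such that for any two distinct vertices $u,v\in V$: $(u,v)\in A$ if and only if $\varphi(u)\cap\varphi(v)\neq\emptyset$ and $|\varphi(u)|\le|\varphi(v)|$. The underlying graph $U(C)$ of a digraph $C$ is the undirected graph on the same vertex set in which two distinct vertices are adjacent iff they are joined by an arc in $C$. A strongly connected component is a maximal strongly connected subdigraph. -}

module Defs where

open import Data.Nat using (ℕ; _≤_)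
open import Data.Fin using (Fin)
open import Data.Fin.Subset using (Subset; _∈_; _⊆_; ∣_∣; _∩_)
open import Data.Bool using (Bool; true; false)
open import Data.Product using (_×_; ∃; Σ)
open import Data.Sum using (_⊎_)
open import Relation.Binary.PropositionalEquality using (_≡_; _≢_)
open import Relation.Nullary using (¬_)

-- A finite digraph on vertex set Fin n, given by a Boolean arc relation
-- with no loops (multiple arcs are impossible in this encoding).
record Digraph (n : ℕ) : Set where
  field
    arc     : Fin n → Fin n → Bool
    loopless : ∀ v → arc v v ≡ false
open Digraph public

Arc : ∀ {n} → Digraph n → Fin n → Fin n → Set
Arc D u v = arc D u v ≡ true

Meets : ∀ {m} → Subset m → Subset m → Set
Meets p q = ∃ λ x → x ∈ p × x ∈ q

IsWDIRep : ∀ {n} → Digraph n → (m : ℕ) → (Fin n → Subset m) → Set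
IsWDIRep {n} D m φ =
  ∀ (u v : Fin n) → u ≢ v →
    (Arc D u v → Meets (φ u) (φ v) × ∣ φ u ∣ ≤ ∣ φ v ∣) ×
    (Meets (φ u) (φ v) × ∣ φ u ∣ ≤ ∣ φ v ∣ → Arc D u v)

HasWDIRep : ∀ {n} → Digraph n → Set
HasWDIRep {n} D = Σ ℕ λ m → Σ (Fin n → Subset m) λ φ → IsWDIRep D m φ

data PathIn {n} (D : Digraph n) (S : Subset n) : Fin n → Fin n → Set where
  here : ∀ {u} → u ∈ S → PathIn D S u u
  step : ∀ {u w v} → u ∈ S → Arc D u w → PathIn D S w v → PathIn D S u v

StronglyConnected : ∀ {n} → Digraph n → Subset n → Set
StronglyConnected D S = ∀ u v → u ∈ S → v ∈ S → PathIn D S u v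

IsSCC : ∀ {n} → Digraph n → Subset n → Set
IsSCC D S =
  (∃ λ v → v ∈ S) ×
  StronglyConnected D S ×
  (∀ T → S ⊆ T → StronglyConnected D T → T ⊆ S)

UAdj : ∀ {n} → Digraph n → Subset n → Fin n → Fin n → Set
UAdj D S u v = u ∈ S × v ∈ S × u ≢ v × (Arc D u v ⊎ Arc D v u)

CArc : ∀ {n} → Digraph n → Subset n → Fin n → Fin n → Set
CArc D S u v = u ∈ S × v ∈ S × Arc D u v

-- C is obtained from U(C) by replacing each edge by a pair of opposite arcs:
-- the arcs of C are exactly the ordered pairs of adjacent vertices of U(C).
IsDoubledUnderlying : ∀ {n} → Digraph n → Subset n → Set
IsDoubledUnderlying D S =
  ∀ u v → (CArc D S u v → UAdj D S u v) × (UAdj D S u v → CArc D S u v)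

{-# OPTIONS --safe #-}
module Submission where

-- Along an arc the sizes of the representing sets weakly increase, so they
-- are constant on every strongly connected component; hence an arc v → u
-- inside a component is matched by u → v, since φ u meets φ v and is no
-- larger. Conversely, let the height of u be the number of vertices that
-- reach u. It weakly increases along arcs, and strictly along an arc v → u
-- unless u reaches v, i.e. unless the arc lies inside a component, where it
-- is doubled by hypothesis. Represent u by the arcs incident with u,
-- padded with private elements to size n² + height u: two sets then meet
-- exactly when the vertices are adjacent, and their sizes decide the
-- direction of the arcs.

open import Defs
open import Data.Nat using (ℕ; zero; suc; _+_; _*_; _≤_; _<_; s≤s; s≤s⁻¹)
open import Data.Nat.Properties
  using (≤-refl; ≤-trans; <-≤-trans; <⇒≱; +-assoc; +-identityʳ; +-monoʳ-≤; +-cancelˡ-≤; m+[n∸m]≡n)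
open import Data.Fin using (Fin; zero; suc; _≟_; remQuot; combine)
open import Data.Fin.Properties using (any?; remQuot-combine)
open import Data.Fin.Subset using (Subset; _∈_; _⊆_; ∣_∣; ⊤; ⊥; ∁; _-_; inside; outside)
open import Data.Fin.Subset.Properties
  using (∈⊤; ∉⊥; ∣⊥∣≡0; ∣p∣≤n; ∣∁p∣≡n∸∣p∣; p⊆q⇒∣p∣≤∣q∣; p⊂q⇒∣p∣<∣q∣; x∈p⇒∣p-x∣<∣p∣; x∈p∧x≢y⇒x∈p-y; p─q⊆p; _∈?_)
open import Data.Bool using (true)
import Data.Bool.Properties as Bool
open import Data.Vec using ([]; _∷_; _++_; tabulate; here; there)
open import Data.Vec.Properties using (lookup∘tabulate; []=⇒lookup; lookup⇒[]=)
open import Data.Product using (_×_; _,_; proj₁; proj₂; ∃-syntax)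
open import Data.Sum using (_⊎_; inj₁; inj₂; [_,_])
import Data.Sum as Sum
open import Data.Empty using (⊥-elim)
open import Function using (_∘_; id)
open import Relation.Nullary using (¬_; Dec; yes; no; does; contradiction)
open import Relation.Nullary.Decidable using (dec-true; map′; _×-dec_; _⊎-dec_)
open import Relation.Unary using (Pred; Decidable)
open import Relation.Binary.PropositionalEquality using (_≡_; _≢_; refl; sym; trans; cong; subst; subst₂; module ≡-Reasoning)

module _ {m p} {P : Pred (Fin m) p} (P? : Decidable P) where

  fromDec : Subset m
  fromDec = tabulate (does ∘ P?)

  ∈-fromDec⁺ : ∀ {x} → P x → x ∈ fromDec
  ∈-fromDec⁺ {x} px = lookup⇒[]= x fromDec (trans (lookup∘tabulate (does ∘ P?) x) (dec-true (P? x) px))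

  ∈-fromDec⁻ : ∀ {x} → x ∈ fromDec → P x
  ∈-fromDec⁻ {x} x∈ with P? x | trans (sym (lookup∘tabulate (does ∘ P?) x)) ([]=⇒lookup x∈)
  ... | yes px | _ = px
  ... | no _   | ()

Meets-sym : ∀ {k} {p q : Subset k} → Meets p q → Meets q p
Meets-sym (x , x∈p , x∈q) = x , x∈q , x∈p

¬Meets-⊥ : ∀ {k} {q : Subset k} → ¬ Meets ⊥ q
¬Meets-⊥ (_ , x∈⊥ , _) = ∉⊥ x∈⊥

Meets-∷ : ∀ {k a b} {p p′ : Subset k} → Meets p p′ → Meets (a ∷ p) (b ∷ p′)
Meets-∷ (x , x∈p , x∈p′) = suc x , there x∈p , there x∈p′

Meets-++⁺ˡ : ∀ {k l} {p p′ : Subset k} (q q′ : Subset l) → Meets p p′ → Meets (p ++ q) (p′ ++ q′)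
Meets-++⁺ˡ q q′ (zero  , here     , here)      = zero , here , here
Meets-++⁺ˡ q q′ (suc x , there x∈p , there x∈p′) = Meets-∷ (Meets-++⁺ˡ q q′ (x , x∈p , x∈p′))

Meets-++⁻ : ∀ {k l} (p p′ : Subset k) {q q′ : Subset l} →
            Meets (p ++ q) (p′ ++ q′) → Meets p p′ ⊎ Meets q q′
Meets-++⁻ [] [] m = inj₂ m
Meets-++⁻ (_ ∷ p) (_ ∷ p′) (zero , here , here) = inj₁ (zero , here , here)
Meets-++⁻ (_ ∷ p) (_ ∷ p′) (suc x , there x∈p , there x∈p′) =
  Sum.map₁ Meets-∷ (Meets-++⁻ p p′ (x , x∈p , x∈p′))

∣p++q∣≡∣p∣+∣q∣ : ∀ {k l} (p : Subset k) (q : Subset l) → ∣ p ++ q ∣ ≡ ∣ p ∣ + ∣ q ∣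
∣p++q∣≡∣p∣+∣q∣ []            q = refl
∣p++q∣≡∣p∣+∣q∣ (inside  ∷ p) q = cong suc (∣p++q∣≡∣p∣+∣q∣ p q)
∣p++q∣≡∣p∣+∣q∣ (outside ∷ p) q = ∣p++q∣≡∣p∣+∣q∣ p q

∣p∣+∣∁p∣≡n : ∀ {k} (p : Subset k) → ∣ p ∣ + ∣ ∁ p ∣ ≡ k
∣p∣+∣∁p∣≡n p = trans (cong (∣ p ∣ +_) (∣∁p∣≡n∸∣p∣ p)) (m+[n∸m]≡n (∣p∣≤n p))

block : ∀ {k l} → Fin k → Subset l → Subset (k * l)
block zero    q = q ++ ⊥
block (suc i) q = ⊥ ++ block i q

∣block∣ : ∀ {k l} (i : Fin k) (q : Subset l) → ∣ block i q ∣ ≡ ∣ q ∣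
∣block∣ {suc k} {l} zero q = begin
  ∣ q ++ ⊥ {n = k * l} ∣     ≡⟨ ∣p++q∣≡∣p∣+∣q∣ q (⊥ {n = k * l}) ⟩
  ∣ q ∣ + ∣ ⊥ {n = k * l} ∣  ≡⟨ cong (∣ q ∣ +_) (∣⊥∣≡0 (k * l)) ⟩
  ∣ q ∣ + 0                  ≡⟨ +-identityʳ ∣ q ∣ ⟩
  ∣ q ∣                      ∎
  where open ≡-Reasoning
∣block∣ {l = l} (suc i) q = begin
  ∣ ⊥ {n = l} ++ block i q ∣     ≡⟨ ∣p++q∣≡∣p∣+∣q∣ (⊥ {n = l}) (block i q) ⟩
  ∣ ⊥ {n = l} ∣ + ∣ block i q ∣  ≡⟨ cong (_+ ∣ block i q ∣) (∣⊥∣≡0 l) ⟩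
  ∣ block i q ∣                  ≡⟨ ∣block∣ i q ⟩
  ∣ q ∣                          ∎
  where open ≡-Reasoning

block-disjoint : ∀ {k l} {i j : Fin k} (q q′ : Subset l) → i ≢ j → ¬ Meets (block i q) (block j q′)
block-disjoint {i = zero}  {zero}  q q′ i≢j _ = i≢j refl
block-disjoint {i = zero}  {suc j} q q′ _ m =
  [ ¬Meets-⊥ ∘ Meets-sym , ¬Meets-⊥ ] (Meets-++⁻ q ⊥ m)
block-disjoint {i = suc i} {zero}  q q′ _ m =
  [ ¬Meets-⊥ , ¬Meets-⊥ ∘ Meets-sym ] (Meets-++⁻ ⊥ q′ m)
block-disjoint {i = suc i} {suc j} q q′ si≢sj m =
  [ ¬Meets-⊥ , block-disjoint q q′ (si≢sj ∘ cong suc) ] (Meets-++⁻ ⊥ ⊥ m)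

module _ {n} (D : Digraph n) where

  Arc? : ∀ u v → Dec (Arc D u v)
  Arc? u v = arc D u v Bool.≟ true

  Arc⇒≢ : ∀ {u v} → Arc D u v → u ≢ v
  Arc⇒≢ {u} uv refl with trans (sym uv) (loopless D u)
  ... | ()

  PathIn-start : ∀ {S u v} → PathIn D S u v → u ∈ S
  PathIn-start (here u∈S)     = u∈S
  PathIn-start (step u∈S _ _) = u∈S

  PathIn-mono : ∀ {S T u v} → S ⊆ T → PathIn D S u v → PathIn D T u v
  PathIn-mono S⊆T (here u∈S)      = here (S⊆T u∈S)
  PathIn-mono S⊆T (step u∈S uw p) = step (S⊆T u∈S) uw (PathIn-mono S⊆T p)

  _◅◅_ : ∀ {S u v w} → PathIn D S u v → PathIn D S v w → PathIn D S u w
  here _       ◅◅ q = q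
  step u∈S a p ◅◅ q = step u∈S a (p ◅◅ q)

  PathIn-monotone : (f : Fin n → ℕ) → (∀ {u v} → Arc D u v → f u ≤ f v) →
                    ∀ {S u v} → PathIn D S u v → f u ≤ f v
  PathIn-monotone f mono (here _)      = ≤-refl
  PathIn-monotone f mono (step _ uw p) = ≤-trans (mono uw) (PathIn-monotone f mono p)

  -- Cutting the path at its last visit to u.
  PathIn-avoid⊎leave : ∀ {S u x v} → u ≢ v → PathIn D S x v →
                       PathIn D (S - u) x v ⊎ (∃[ w ] Arc D u w × PathIn D (S - u) w v)
  PathIn-avoid⊎leave u≢v (here v∈S) = inj₁ (here (x∈p∧x≢y⇒x∈p-y v∈S (u≢v ∘ sym)))
  PathIn-avoid⊎leave {u = u} u≢v (step {x} x∈S xw p) with PathIn-avoid⊎leave u≢v p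
  ... | inj₂ leave = inj₂ leave
  ... | inj₁ q with x ≟ u
  ...   | yes refl = inj₂ (_ , xw , q)
  ...   | no x≢u   = inj₁ (step (x∈p∧x≢y⇒x∈p-y x∈S x≢u) xw q)

  PathIn-leave : ∀ {S u v} → u ≢ v → PathIn D S u v → ∃[ w ] Arc D u w × PathIn D (S - u) w v
  PathIn-leave u≢u (here _)      = contradiction refl u≢u
  PathIn-leave u≢v (step _ uw p) = [ (λ q → _ , uw , q) , id ] (PathIn-avoid⊎leave u≢v p)

  PathIn?-bounded : ∀ k S → ∣ S ∣ < k → ∀ u v → Dec (PathIn D S u v)
  PathIn?-bounded zero    S () u v
  PathIn?-bounded (suc k) S ∣S∣<1+k u v with u ∈? S | u ≟ v
  ... | no u∉S  | _        = no (u∉S ∘ PathIn-start)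
  ... | yes u∈S | yes refl = yes (here u∈S)
  ... | yes u∈S | no u≢v   =
    map′ (λ (w , uw , p) → step u∈S uw (PathIn-mono (p─q⊆p S _) p))
         (PathIn-leave u≢v)
         (any? λ w → Arc? u w ×-dec PathIn?-bounded k (S - u) ∣S-u∣<k w v)
    where
    ∣S-u∣<k : ∣ S - u ∣ < k
    ∣S-u∣<k = <-≤-trans (x∈p⇒∣p-x∣<∣p∣ u∈S) (s≤s⁻¹ ∣S∣<1+k)

  Reaches : Fin n → Fin n → Set
  Reaches = PathIn D ⊤

  Reaches? : ∀ u v → Dec (Reaches u v)
  Reaches? = PathIn?-bounded (suc n) ⊤ (s≤s (∣p∣≤n ⊤))

  arc⇒Reaches : ∀ {u v} → Arc D u v → Reaches u v
  arc⇒Reaches uv = step ∈⊤ uv (here ∈⊤)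

  component : Fin n → Subset n
  component u = fromDec (λ w → Reaches? u w ×-dec Reaches? w u)

  ∈-component⁺ : ∀ {u w} → Reaches u w → Reaches w u → w ∈ component u
  ∈-component⁺ {u} uw wu = ∈-fromDec⁺ (λ w → Reaches? u w ×-dec Reaches? w u) (uw , wu)

  ∈-component⁻ : ∀ {u w} → w ∈ component u → Reaches u w × Reaches w u
  ∈-component⁻ {u} = ∈-fromDec⁻ (λ w → Reaches? u w ×-dec Reaches? w u)

  u∈component : ∀ u → u ∈ component u
  u∈component u = ∈-component⁺ (here ∈⊤) (here ∈⊤)

  Reaches⇒PathIn-component : ∀ {u x y} → Reaches u x → Reaches y u → Reaches x y → PathIn D (component u) x y
  Reaches⇒PathIn-component ux yu (here _)        = here (∈-component⁺ ux yu)
  Reaches⇒PathIn-component ux yu (step _ xw wy) =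
    step (∈-component⁺ ux (step ∈⊤ xw wy ◅◅ yu)) xw
         (Reaches⇒PathIn-component (ux ◅◅ arc⇒Reaches xw) yu wy)

  component-stronglyConnected : ∀ u → StronglyConnected D (component u)
  component-stronglyConnected u x y x∈ y∈ with ∈-component⁻ x∈ | ∈-component⁻ y∈
  ... | ux , xu | uy , yu = Reaches⇒PathIn-component ux yu (xu ◅◅ uy)

  stronglyConnected⊆component : ∀ {T u} → StronglyConnected D T → u ∈ T → T ⊆ component u
  stronglyConnected⊆component {u = u} scT u∈T t∈T =
    ∈-component⁺ (PathIn-mono (λ _ → ∈⊤) (scT u _ u∈T t∈T)) (PathIn-mono (λ _ → ∈⊤) (scT _ u t∈T u∈T))

  component-isSCC : ∀ u → IsSCC D (component u)
  component-isSCC u =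
    (u , u∈component u) ,
    component-stronglyConnected u ,
    λ T C⊆T scT → stronglyConnected⊆component scT (C⊆T (u∈component u))

  IsWDIRep⇒∣φ∣-mono : ∀ {m φ} → IsWDIRep D m φ → ∀ {u v} → Arc D u v → ∣ φ u ∣ ≤ ∣ φ v ∣
  IsWDIRep⇒∣φ∣-mono rep {u} {v} uv = proj₂ (proj₁ (rep u v (Arc⇒≢ uv)) uv)

  IsWDIRep⇒stronglyConnected-doubled : ∀ {m φ} → IsWDIRep D m φ →
                                       ∀ {C} → StronglyConnected D C → IsDoubledUnderlying D C
  IsWDIRep⇒stronglyConnected-doubled {φ = φ} rep {C} sc u v = toUAdj , toCArc
    where
    toUAdj : CArc D C u v → UAdj D C u v
    toUAdj (u∈C , v∈C , uv) = u∈C , v∈C , Arc⇒≢ uv , inj₁ uv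
    toCArc : UAdj D C u v → CArc D C u v
    toCArc (u∈C , v∈C , _   , inj₁ uv) = u∈C , v∈C , uv
    toCArc (u∈C , v∈C , u≢v , inj₂ vu) =
      u∈C , v∈C , proj₂ (rep u v u≢v)
        (Meets-sym (proj₁ (proj₁ (rep v u (Arc⇒≢ vu)) vu)) ,
         PathIn-monotone (∣_∣ ∘ φ) (IsWDIRep⇒∣φ∣-mono rep) (sc u v u∈C v∈C))

  DoubledSCCs : Set
  DoubledSCCs = ∀ C → IsSCC D C → IsDoubledUnderlying D C

  DoubledSCCs⇒reverse-arc : DoubledSCCs → ∀ {u v} → Arc D v u → Reaches u v → Arc D u v
  DoubledSCCs⇒reverse-arc doubled {u} {v} vu uv =
    proj₂ (proj₂ (proj₂ (doubled (component u) (component-isSCC u) u v)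
      (u∈component u , ∈-component⁺ uv (arc⇒Reaches vu) , Arc⇒≢ vu ∘ sym , inj₂ vu)))

  ancestors : Fin n → Subset n
  ancestors u = fromDec (λ w → Reaches? w u)

  height : Fin n → ℕ
  height u = ∣ ancestors u ∣

  ∈-ancestors⁺ : ∀ {u w} → Reaches w u → w ∈ ancestors u
  ∈-ancestors⁺ {u} = ∈-fromDec⁺ (λ w → Reaches? w u)

  ∈-ancestors⁻ : ∀ {u w} → w ∈ ancestors u → Reaches w u
  ∈-ancestors⁻ {u} = ∈-fromDec⁻ (λ w → Reaches? w u)

  ancestors-mono : ∀ {u v} → Arc D u v → ancestors u ⊆ ancestors v
  ancestors-mono uv w∈ = ∈-ancestors⁺ (∈-ancestors⁻ w∈ ◅◅ arc⇒Reaches uv)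

  height-mono : ∀ {u v} → Arc D u v → height u ≤ height v
  height-mono uv = p⊆q⇒∣p∣≤∣q∣ (ancestors-mono uv)

  height-strict : ∀ {u v} → Arc D v u → ¬ Reaches u v → height v < height u
  height-strict vu ¬uv =
    p⊂q⇒∣p∣<∣q∣ (ancestors-mono vu , _ , ∈-ancestors⁺ (here ∈⊤) , ¬uv ∘ ∈-ancestors⁻)

  Incident : Fin n → Fin n × Fin n → Set
  Incident u (a , b) = Arc D a b × (a ≡ u ⊎ b ≡ u)

  Incident? : ∀ u ab → Dec (Incident u ab)
  Incident? u (a , b) = Arc? a b ×-dec (a ≟ u ⊎-dec b ≟ u)

  incidentArcs : Fin n → Subset (n * n)
  incidentArcs u = fromDec (Incident? u ∘ remQuot n)

  incidentArcs-meet : ∀ {u v} → Arc D u v → Meets (incidentArcs u) (incidentArcs v)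
  incidentArcs-meet {u} {v} uv =
    combine u v ,
    ∈-fromDec⁺ (Incident? u ∘ remQuot n) (incident (uv , inj₁ refl)) ,
    ∈-fromDec⁺ (Incident? v ∘ remQuot n) (incident (uv , inj₂ refl))
    where
    incident : ∀ {w} → Incident w (u , v) → Incident w (remQuot n (combine u v))
    incident {w} = subst (Incident w) (sym (remQuot-combine u v))

  incident⇒adjacent : ∀ {u v ab} → u ≢ v → Incident u ab → Incident v ab → Arc D u v ⊎ Arc D v u
  incident⇒adjacent u≢v (_  , inj₁ refl) (_ , inj₁ refl) = contradiction refl u≢v
  incident⇒adjacent u≢v (uv , inj₁ refl) (_ , inj₂ refl) = inj₁ uv
  incident⇒adjacent u≢v (vu , inj₂ refl) (_ , inj₁ refl) = inj₂ vu
  incident⇒adjacent u≢v (_  , inj₂ refl) (_ , inj₂ refl) = contradiction refl u≢v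

  incidentArcs-meet⇒adjacent : ∀ {u v} → u ≢ v → Meets (incidentArcs u) (incidentArcs v) →
                               Arc D u v ⊎ Arc D v u
  incidentArcs-meet⇒adjacent {u} {v} u≢v (x , x∈u , x∈v) =
    incident⇒adjacent u≢v (∈-fromDec⁻ (Incident? u ∘ remQuot n) x∈u)
                          (∈-fromDec⁻ (Incident? v ∘ remQuot n) x∈v)

  -- The private block of u holds the complement of its incident arcs and a
  -- copy of its ancestors, which pads φ u to size n * n + height u.
  φ : Fin n → Subset (n * n + n * (n * n + n))
  φ u = incidentArcs u ++ block u (∁ (incidentArcs u) ++ ancestors u)

  ∣φ∣ : ∀ u → ∣ φ u ∣ ≡ n * n + height u
  ∣φ∣ u = begin
    ∣ E ++ block u (∁ E ++ A) ∣      ≡⟨ ∣p++q∣≡∣p∣+∣q∣ E _ ⟩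
    ∣ E ∣ + ∣ block u (∁ E ++ A) ∣   ≡⟨ cong (∣ E ∣ +_) (trans (∣block∣ u _) (∣p++q∣≡∣p∣+∣q∣ (∁ E) A)) ⟩
    ∣ E ∣ + (∣ ∁ E ∣ + ∣ A ∣)        ≡⟨ sym (+-assoc ∣ E ∣ _ _) ⟩
    ∣ E ∣ + ∣ ∁ E ∣ + ∣ A ∣          ≡⟨ cong (_+ ∣ A ∣) (∣p∣+∣∁p∣≡n E) ⟩
    n * n + height u                 ∎
    where
    open ≡-Reasoning
    E = incidentArcs u
    A = ancestors u

  φ-meet⇒adjacent : ∀ {u v} → u ≢ v → Meets (φ u) (φ v) → Arc D u v ⊎ Arc D v u
  φ-meet⇒adjacent {u} {v} u≢v m =
    [ incidentArcs-meet⇒adjacent u≢v , ⊥-elim ∘ block-disjoint _ _ u≢v ]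
      (Meets-++⁻ (incidentArcs u) (incidentArcs v) m)

  DoubledSCCs⇒IsWDIRep : DoubledSCCs → IsWDIRep D _ φ
  DoubledSCCs⇒IsWDIRep doubled u v u≢v = representsArc , fromRepresentation
    where
    representsArc : Arc D u v → Meets (φ u) (φ v) × ∣ φ u ∣ ≤ ∣ φ v ∣
    representsArc uv =
      Meets-++⁺ˡ _ _ (incidentArcs-meet uv) ,
      subst₂ _≤_ (sym (∣φ∣ u)) (sym (∣φ∣ v)) (+-monoʳ-≤ (n * n) (height-mono uv))
    fromRepresentation : Meets (φ u) (φ v) × ∣ φ u ∣ ≤ ∣ φ v ∣ → Arc D u v
    fromRepresentation (m , ∣φu∣≤∣φv∣) with φ-meet⇒adjacent u≢v m | Reaches? u v
    ... | inj₁ uv | _      = uv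
    ... | inj₂ vu | yes uv = DoubledSCCs⇒reverse-arc doubled vu uv
    ... | inj₂ vu | no ¬uv =
      contradiction (+-cancelˡ-≤ (n * n) _ _ (subst₂ _≤_ (∣φ∣ u) (∣φ∣ v) ∣φu∣≤∣φv∣))
                    (<⇒≱ (height-strict vu ¬uv))

proposition2 : ∀ {n : ℕ} (D : Digraph n) →
    (HasWDIRep D → ∀ (C : Subset n) → IsSCC D C → IsDoubledUnderlying D C) ×
    ((∀ (C : Subset n) → IsSCC D C → IsDoubledUnderlying D C) → HasWDIRep D)
proposition2 D =
  (λ (_ , _ , rep) C (_ , sc , _) → IsWDIRep⇒stronglyConnected-doubled D rep sc) ,
  (λ doubled → _ , φ D , DoubledSCCs⇒IsWDIRep D doubled)
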